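{- Let $s,t$ be real numbers with $s\neq0$, $t\neq0$. For every positive integer $n$: (1) $\genfrac{\{}{\}}{0pt}{}{n+2}{2}_{s,t}=t\genfrac{\{}{\}}{0pt}{}{n+1}{2}_{s,t}+\{n+1\}_{s,t}^2$; (2) $\varphi_{s,t}^{n+1}\genfrac{\{}{\}}{0pt}{}{n}{2}_{s,t}+\varphi_{s,t}^{\prime\,(n-1)}\genfrac{\{}{\}}{0pt}{}{n+1}{2}_{s,t}=\frac{\langle n\rangle_{s,t}}{\{2\}_{s,t}}\{n\}_{s,t}^2$, where $\langle n\rangle_{s,t}=\varphi_{s,t}^n+\varphi_{s,t}^{\prime\,n}$; (3) $\genfrac{\{}{\}}{0pt}{}{n+1}{2}_{s,t}=\sum_{k=1}^{n}t^{n-k}\{k\}_{s,t}^2$.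
   Context: The generalized Fibonacci polynomials $\{n\}_{s,t}$ are defined by $\{0\}_{s,t}=0$, $\{1\}_{s,t}=1$, $\{n+2\}_{s,t}=s\{n+1\}_{s,t}+t\{n\}_{s,t}$ (so $\{2\}_{s,t}=s$). Set $\varphi_{s,t}=\frac{s+\sqrt{s^2+4t}}{2}$ and $\varphi'_{s,t}=\frac{s-\sqrt{s^2+4t}}{2}$; exponents on $\varphi'_{s,t}$ denote ordinary powers. The generalized triangular numbers are $\genfrac{\{}{\}}{0pt}{}{m}{2}_{s,t}=\frac{\{m-1\}_{s,t}\{m\}_{s,t}}{\{2\}_{s,t}}$ for integers $m\geq1$. -}

module Defs where

open import Level using (_⊔_)
open import Data.Nat using (ℕ; zero; suc; _∸_)
open import Algebra.Bundles using (CommutativeRing)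

module _ {c ℓ} (R : CommutativeRing c ℓ) where
  open CommutativeRing R

  pow : Carrier → ℕ → Carrier
  pow x zero    = 1#
  pow x (suc n) = x * pow x n

  two four : Carrier
  two  = 1# + 1#
  four = two + two

  fib : Carrier → Carrier → ℕ → Carrier
  fib s t zero          = 0#
  fib s t (suc zero)    = 1#
  fib s t (suc (suc n)) = s * fib s t (suc n) + t * fib s t n

  -- generalized triangular number {m choose 2}_{s,t} = {m-1}{m} / {2},
  -- where sinv is the inverse of {2}_{s,t} = s  (used for m ≥ 1)
  tri : Carrier → Carrier → Carrier → ℕ → Carrier
  tri s t sinv m = (fib s t (m ∸ 1) * fib s t m) * sinv

  -- φ = (s + r)/2 and φ' = (s - r)/2, r a square root of s² + 4t, half = 1/2
  phi phi' : Carrier → Carrier → Carrier → Carrier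
  phi  half s r = (s + r) * half
  phi' half s r = (s - r) * half

  luc : Carrier → Carrier → Carrier → ℕ → Carrier
  luc half s r n = pow (phi half s r) n + pow (phi' half s r) n

  sumSq : Carrier → Carrier → ℕ → ℕ → Carrier
  sumSq s t n zero    = 0#
  sumSq s t n (suc k) = sumSq s t n k + pow t (n ∸ suc k) * (fib s t (suc k) * fib s t (suc k))

{-# OPTIONS --safe #-}
module Submission where

-- φ and φ' are the roots of x² = s x + t, which gives the Binet-type recurrence
-- {k+1} = φ {k} + φ'ᵏ (and the same with φ, φ' exchanged). Identity (1) is the
-- defining recurrence multiplied by {n+1}/{2}, and (3) follows from (1) by induction.
-- Substituting {n+1} = φ' {n} + φⁿ reduces (2) to the recurrence
-- {n} = φ {n-1} + φ'^(n-1) multiplied by φⁿ {n}/{2}.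

open import Defs
open import Data.Nat using (ℕ; zero; suc; _∸_; _≥_; _≤_; s≤s)
import Data.Nat.Properties as ℕ
open import Data.Product using (_×_; _,_)
open import Relation.Nullary using (¬_)
open import Relation.Binary.PropositionalEquality using (cong)
open import Algebra.Bundles using (CommutativeRing)

module FibonacciIdentities {c ℓ} (R : CommutativeRing c ℓ) where
  open CommutativeRing R
  open import Algebra.Solver.Ring.NaturalCoefficients.Default commutativeSemiring
    using (solve; _:=_; _:+_; _:*_; con)
  open import Relation.Binary.Reasoning.Setoid setoid

  -- p and q are the two roots of x² = s x + t, in the form of Vieta's formulas.
  record RootsOf (s t p q : Carrier) : Set ℓ where
    field
      sum≈     : s ≈ p + q
      product≈ : t + p * q ≈ 0#

  RootsOf-swap : ∀ {s t p q} → RootsOf s t p q → RootsOf s t q p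
  RootsOf-swap roots = record
    { sum≈     = trans sum≈ (+-comm _ _)
    ; product≈ = trans (+-cong refl (*-comm _ _)) product≈
    }
    where open RootsOf roots

  -- The solver only has natural coefficients, so - r enters it as a separate atom m, with r + m ≈ 0.
  phi-phi'-roots : ∀ {s t r half} → two R * half ≈ 1# → r * r ≈ s * s + four R * t →
                   RootsOf s t (phi R half s r) (phi' R half s r)
  phi-phi'-roots {s} {t} {r} {half} 2h≈1 r²≈s²+4t = record { sum≈ = sum≈ ; product≈ = product≈ }
    where
    r-r≈0 : r + - r ≈ 0#
    r-r≈0 = -‿inverseʳ r

    sum≈ : s ≈ (s + r) * half + (s - r) * half
    sum≈ = sym (begin
      (s + r) * half + (s - r) * half
        ≈⟨ solve 4 (λ s r m h → (s :+ r) :* h :+ (s :+ m) :* h := s :* (con 2 :* h) :+ (r :+ m) :* h)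
                   refl s r (- r) half ⟩
      s * (two R * half) + (r - r) * half  ≈⟨ +-cong (*-cong refl 2h≈1) (*-cong r-r≈0 refl) ⟩
      s * 1# + 0# * half                   ≈⟨ +-cong (*-identityʳ s) (zeroˡ half) ⟩
      s + 0#                               ≈⟨ +-identityʳ s ⟩
      s                                    ∎)

    t≈t*[2h]² : t ≈ t * ((two R * half) * (two R * half))
    t≈t*[2h]² = sym (begin
      t * ((two R * half) * (two R * half))  ≈⟨ *-cong refl (*-cong 2h≈1 2h≈1) ⟩
      t * (1# * 1#)                          ≈⟨ *-cong refl (*-identityʳ 1#) ⟩
      t * 1#                                 ≈⟨ *-identityʳ t ⟩
      t                                      ∎)

    product≈ : t + (s + r) * half * ((s - r) * half) ≈ 0#
    product≈ = begin
      t + (s + r) * half * ((s - r) * half)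
        ≈⟨ +-cong t≈t*[2h]² refl ⟩
      t * ((two R * half) * (two R * half)) + (s + r) * half * ((s - r) * half)
        ≈⟨ solve 5 (λ t s r m h → t :* ((con 2 :* h) :* (con 2 :* h)) :+ (s :+ r) :* h :* ((s :+ m) :* h)
                                := h :* h :* (s :* s :+ (con 2 :+ con 2) :* t :+ r :* m) :+ h :* h :* s :* (r :+ m))
                   refl t s r (- r) half ⟩
      half * half * (s * s + four R * t + r * - r) + half * half * s * (r - r)
        ≈⟨ +-cong (*-cong refl (+-cong (sym r²≈s²+4t) refl)) (*-cong refl r-r≈0) ⟩
      half * half * (r * r + r * - r) + half * half * s * 0#
        ≈⟨ solve 4 (λ h r m s → h :* h :* (r :* r :+ r :* m) :+ h :* h :* s :* con 0 := h :* h :* r :* (r :+ m))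
                   refl half r (- r) s ⟩
      half * half * r * (r - r)            ≈⟨ *-cong refl r-r≈0 ⟩
      half * half * r * 0#                 ≈⟨ zeroʳ _ ⟩
      0#                                   ∎

  module _ {s t : Carrier} where

    private
      F : ℕ → Carrier
      F = fib R s t

    fib-suc-binet : ∀ {p q} → RootsOf s t p q → ∀ k → F (suc k) ≈ p * F k + pow R q k
    fib-suc-binet {p} _ zero = sym (trans (+-cong (zeroʳ p) refl) (+-identityˡ 1#))
    fib-suc-binet {p} {q} roots (suc k) = begin
      s * F (suc k) + t * F k                              ≈⟨ +-cong (*-cong sum≈ refl) refl ⟩
      (p + q) * F (suc k) + t * F k                        ≈⟨ +-cong (distribʳ (F (suc k)) p q) refl ⟩
      p * F (suc k) + q * F (suc k) + t * F k              ≈⟨ +-cong (+-cong refl (*-cong refl (fib-suc-binet roots k))) refl ⟩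
      p * F (suc k) + q * (p * F k + pow R q k) + t * F k
        ≈⟨ solve 6 (λ p q b a Q t → p :* b :+ q :* (p :* a :+ Q) :+ t :* a := p :* b :+ q :* Q :+ (t :+ p :* q) :* a)
                   refl p q (F (suc k)) (F k) (pow R q k) t ⟩
      p * F (suc k) + q * pow R q k + (t + p * q) * F k    ≈⟨ +-cong refl (*-cong product≈ refl) ⟩
      p * F (suc k) + q * pow R q k + 0# * F k             ≈⟨ +-cong refl (zeroˡ (F k)) ⟩
      p * F (suc k) + q * pow R q k + 0#                   ≈⟨ +-identityʳ _ ⟩
      p * F (suc k) + q * pow R q k                        ∎
      where open RootsOf roots

    tri-suc-suc : ∀ {sinv} → s * sinv ≈ 1# → ∀ n →
                  tri R s t sinv (suc (suc n)) ≈ t * tri R s t sinv (suc n) + F (suc n) * F (suc n)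
    tri-suc-suc {sinv} s*sinv≈1 n = begin
      (b * (s * b + t * a)) * sinv
        ≈⟨ solve 5 (λ s t i a b → (b :* (s :* b :+ t :* a)) :* i := b :* b :* (s :* i) :+ t :* ((a :* b) :* i))
                   refl s t sinv a b ⟩
      b * b * (s * sinv) + t * ((a * b) * sinv)  ≈⟨ +-cong (*-cong refl s*sinv≈1) refl ⟩
      b * b * 1# + t * ((a * b) * sinv)          ≈⟨ +-cong (*-identityʳ (b * b)) refl ⟩
      b * b + t * ((a * b) * sinv)               ≈⟨ +-comm (b * b) _ ⟩
      t * ((a * b) * sinv) + b * b               ∎
      where
      a b : Carrier
      a = F n
      b = F (suc n)

    sumSq-suc : ∀ {n k} → k ≤ n → sumSq R s t (suc n) k ≈ t * sumSq R s t n k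
    sumSq-suc {k = zero} _ = sym (zeroʳ t)
    sumSq-suc {suc n} {suc k} (s≤s k≤n) = begin
      sumSq R s t (suc (suc n)) k + pow R t (suc n ∸ k) * F²
        ≈⟨ +-cong (sumSq-suc (ℕ.m≤n⇒m≤1+n k≤n)) (*-cong (reflexive (cong (pow R t) (ℕ.+-∸-assoc 1 k≤n))) refl) ⟩
      t * sumSq R s t (suc n) k + t * pow R t (n ∸ k) * F²    ≈⟨ +-cong refl (*-assoc t _ F²) ⟩
      t * sumSq R s t (suc n) k + t * (pow R t (n ∸ k) * F²)  ≈⟨ distribˡ t _ _ ⟨
      t * (sumSq R s t (suc n) k + pow R t (n ∸ k) * F²)      ∎
      where
      F² : Carrier
      F² = F (suc k) * F (suc k)

    tri-suc≈sumSq : ∀ {sinv} → s * sinv ≈ 1# → ∀ n → tri R s t sinv (suc n) ≈ sumSq R s t n n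
    tri-suc≈sumSq {sinv} _ zero = trans (*-cong (zeroˡ 1#) refl) (zeroˡ sinv)
    tri-suc≈sumSq {sinv} s*sinv≈1 (suc n) = begin
      tri R s t sinv (suc (suc n))                  ≈⟨ tri-suc-suc s*sinv≈1 n ⟩
      t * tri R s t sinv (suc n) + F²               ≈⟨ +-cong (*-cong refl (tri-suc≈sumSq s*sinv≈1 n)) refl ⟩
      t * sumSq R s t n n + F²                      ≈⟨ +-cong (sumSq-suc (ℕ.≤-refl {n})) (*-identityˡ F²) ⟨
      sumSq R s t (suc n) n + 1# * F²               ≈⟨ +-cong refl (*-cong (reflexive (cong (pow R t) (ℕ.n∸n≡0 n))) refl) ⟨
      sumSq R s t (suc n) (suc n)                   ∎
      where
      F² : Carrier
      F² = F (suc n) * F (suc n)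

    pow-tri+pow-tri≈lucas*fib² : ∀ {p q sinv} → RootsOf s t p q → ∀ m →
      pow R p (suc (suc m)) * tri R s t sinv (suc m) + pow R q m * tri R s t sinv (suc (suc m))
        ≈ ((pow R p (suc m) + pow R q (suc m)) * sinv) * (F (suc m) * F (suc m))
    pow-tri+pow-tri≈lucas*fib² {p} {q} {sinv} roots m = begin
      p * (p * P) * ((a * b) * sinv) + Q * ((b * F (suc (suc m))) * sinv)
        ≈⟨ +-cong refl (*-cong refl (*-cong (*-cong refl c≈) refl)) ⟩
      p * (p * P) * ((a * b) * sinv) + Q * ((b * (q * b + p * P)) * sinv)
        ≈⟨ solve 7 (λ p q P Q a b i → p :* (p :* P) :* ((a :* b) :* i) :+ Q :* ((b :* (q :* b :+ p :* P)) :* i)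
                                    := (p :* P :* i) :* (b :* (p :* a :+ Q)) :+ (q :* Q :* i) :* (b :* b))
                   refl p q P Q a b sinv ⟩
      (p * P * sinv) * (b * (p * a + Q)) + (q * Q * sinv) * (b * b)
        ≈⟨ +-cong (*-cong refl (*-cong refl b≈)) refl ⟨
      (p * P * sinv) * (b * b) + (q * Q * sinv) * (b * b)
        ≈⟨ trans (*-cong (distribʳ sinv _ _) refl) (distribʳ (b * b) _ _) ⟨
      ((p * P + q * Q) * sinv) * (b * b)
        ∎
      where
      P Q a b : Carrier
      P = pow R p m
      Q = pow R q m
      a = F m
      b = F (suc m)

      b≈ : b ≈ p * a + Q
      b≈ = fib-suc-binet roots m

      c≈ : F (suc (suc m)) ≈ q * b + p * P
      c≈ = fib-suc-binet (RootsOf-swap roots) (suc m)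

theorem2 : ∀ {c ℓ} (R : CommutativeRing c ℓ) →
    let open CommutativeRing R in
    (s t r sinv half : Carrier) →
    ¬ (s ≈ 0#) → ¬ (t ≈ 0#) →
    s * sinv ≈ 1# → two R * half ≈ 1# →
    r * r ≈ s * s + four R * t →
    (n : ℕ) → n ≥ 1 →
      (tri R s t sinv (n Data.Nat.+ 2)
         ≈ t * tri R s t sinv (n Data.Nat.+ 1) + fib R s t (n Data.Nat.+ 1) * fib R s t (n Data.Nat.+ 1))
      × (pow R (phi R half s r) (n Data.Nat.+ 1) * tri R s t sinv n
           + pow R (phi' R half s r) (n ∸ 1) * tri R s t sinv (n Data.Nat.+ 1)
         ≈ (luc R half s r n * sinv) * (fib R s t n * fib R s t n))
      × (tri R s t sinv (n Data.Nat.+ 1) ≈ sumSq R s t n n)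
theorem2 R s t r sinv half _ _ s*sinv≈1 2*half≈1 r²≈s²+4t (suc m) (s≤s _)
  rewrite ℕ.+-comm m 2 | ℕ.+-comm m 1 =
    tri-suc-suc s*sinv≈1 (suc m) ,
    pow-tri+pow-tri≈lucas*fib² (phi-phi'-roots 2*half≈1 r²≈s²+4t) m ,
    tri-suc≈sumSq s*sinv≈1 (suc m)
  where open FibonacciIdentities R
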